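{- Let $H$ be a finite group generated by $s_1,\dots,s_k$, let $F=\widehat F(s_1,\dots,s_k)$ be the profinite completion of the free group on $s_1,\dots,s_k$, and let $R$ be the kernel of the natural surjection $F\to H$, so $H\cong F/R$. Let $E^1,E^2$ be finite groups with a common normal subgroup $N$, and let $s^j_i\in E^j$ ($j=1,2$, $i=1,\dots,k$) be such that there is an isomorphism $E^j/N\to H$ sending $s^j_iN$ to $s_i$ for each $i$. Suppose that $a^{s^1_i}=a^{s^2_i}$ for all $a\in N$ and all $i=1,\dots,k$. Then there is an isomorphism $E^1\to E^2$ fixing $N$ pointwise and taking $s^1_i$ to $s^2_i$ for all $i$ if and only if $\phi_{E^1}=\phi_{E^2}$.
   Context: For $j=1,2$, $\phi_{E^j}:R\to N$ is the unique continuous homomorphism such that $\phi_{E^j}(w(s_1,\dots,s_k))=w(s^j_1,\dots,s^j_k)$ for every group word $w$ with $w(s_1,\dots,s_k)\in R$ (such words form a dense subset of $R$, and $w(s^j_1,\dots,s^j_k)\in N$ for them); $N$ carries the discrete topology. For $a\in N$, $a^{s}=s^{ -1}as$. -}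

module Defs where

open import Level using (Level; _⊔_)
open import Data.Nat using (ℕ)
open import Data.Fin using (Fin)
open import Data.Product using (Σ; _×_; ∃)
open import Function.Bundles using (_⇔_)
open import Algebra.Bundles using (Group)
open import Algebra.Morphism.Structures using (module GroupMorphisms)

private variable c ℓ c₁ ℓ₁ c₂ ℓ₂ : Level

module _ (G : Group c₁ ℓ₁) (K : Group c₂ ℓ₂) where
  open GroupMorphisms (Group.rawGroup G) (Group.rawGroup K)

  IsHom : (Group.Carrier G → Group.Carrier K) → Set (c₁ ⊔ ℓ₁ ⊔ ℓ₂)
  IsHom = IsGroupHomomorphism

  IsMono : (Group.Carrier G → Group.Carrier K) → Set (c₁ ⊔ ℓ₁ ⊔ ℓ₂)
  IsMono = IsGroupMonomorphism

  IsIso : (Group.Carrier G → Group.Carrier K) → Set (c₁ ⊔ c₂ ⊔ ℓ₁ ⊔ ℓ₂)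
  IsIso = IsGroupIsomorphism

Finite : Group c ℓ → Set (c ⊔ ℓ)
Finite G = Σ ℕ λ n → Σ (Fin n → Carrier) λ e → ∀ x → ∃ λ i → e i ≈ x
  where open Group G

data Word (k : ℕ) : Set where
  ε′   : Word k
  gen  : Fin k → Word k
  inv  : Word k → Word k
  _·_  : Word k → Word k → Word k

eval : (G : Group c ℓ) {k : ℕ} → (Fin k → Group.Carrier G) → Word k → Group.Carrier G
eval G g ε′ = Group.ε G
eval G g (gen i) = g i
eval G g (inv w) = Group._⁻¹ G (eval G g w)
eval G g (w · v) = Group._∙_ G (eval G g w) (eval G g v)

Generates : (G : Group c ℓ) {k : ℕ} → (Fin k → Group.Carrier G) → Set (c ⊔ ℓ)
Generates G g = ∀ x → ∃ λ w → Group._≈_ G (eval G g w) x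

conj : (G : Group c ℓ) → Group.Carrier G → Group.Carrier G → Group.Carrier G
conj G a s = (s ⁻¹ ∙ a) ∙ s
  where open Group G

IsNormalEmbedding : (N E : Group c ℓ) → (Group.Carrier N → Group.Carrier E) → Set (c ⊔ ℓ)
IsNormalEmbedding N E ι =
  IsMono N E ι × (∀ a g → ∃ λ b → Group._≈_ E (ι b) (conj E (ι a) g))

-- π : E → H is surjective with kernel exactly ι(N), i.e. it induces E/N ≅ H.
IsQuotientBy : (N E H : Group c ℓ) → (Group.Carrier N → Group.Carrier E)
             → (Group.Carrier E → Group.Carrier H) → Set (c ⊔ ℓ)
IsQuotientBy N E H ι π =
  IsHom E H π
  × (∀ h → ∃ λ x → Group._≈_ H (π x) h)
  × (∀ x → Group._≈_ H (π x) (Group.ε H) ⇔ (∃ λ a → Group._≈_ E (ι a) x))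

-- φ_{E¹} = φ_{E²}: for every word w lying in R (i.e. w(s₁,…,s_k) = 1 in H),
-- the elements w(s¹) ∈ N ⊆ E¹ and w(s²) ∈ N ⊆ E² are the same element of N.
PhiEqual : (H N E₁ E₂ : Group c ℓ) {k : ℕ} (s : Fin k → Group.Carrier H)
           (ι₁ : Group.Carrier N → Group.Carrier E₁) (ι₂ : Group.Carrier N → Group.Carrier E₂)
           (s¹ : Fin k → Group.Carrier E₁) (s² : Fin k → Group.Carrier E₂) → Set (c ⊔ ℓ)
PhiEqual H N E₁ E₂ s ι₁ ι₂ s¹ s² =
  ∀ w → Group._≈_ H (eval H s w) (Group.ε H) →
    ∃ λ a → Group._≈_ E₁ (ι₁ a) (eval E₁ s¹ w) × Group._≈_ E₂ (ι₂ a) (eval E₂ s² w)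

{-# OPTIONS --safe #-}
module Submission where

-- Since the sᵢ generate H ≅ Eʲ/N, every element of Eʲ has the form w(sʲ)·a with w a word and a ∈ N.
-- Two such forms w(s¹)·a and v(s¹)·b are equal exactly when v⁻¹w lies in R with φ(v⁻¹w) = b·a⁻¹; so if
-- φ_{E¹} = φ_{E²}, then w(s¹)·a ↦ w(s²)·a is a well-defined bijection E¹ → E². It is multiplicative because
-- conjugation by w(s¹) and by w(s²) agree on N for every word w, not only for the generators. Conversely,
-- an isomorphism fixing N and sending s¹ to s² sends w(s¹) to w(s²), which forces φ_{E¹} = φ_{E²}.

open import Level using (Level; _⊔_)
open import Data.Nat using (ℕ)
open import Data.Fin using (Fin)
open import Data.Product using (Σ; _×_; ∃; ∃₂; _,_; proj₁; proj₂)
open import Function.Bundles using (_⇔_; mk⇔; Equivalence)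
open import Algebra.Bundles using (Group)
open import Algebra.Morphism.Structures using (module GroupMorphisms)
import Algebra.Properties.Group as GroupProperties
import Relation.Binary.Reasoning.Setoid as ≈-Reasoning
open import Defs

private variable c ℓ c₁ ℓ₁ c₂ ℓ₂ : Level

module DivisionProperties (G : Group c ℓ) where
  open Group G
  open GroupProperties G
  open ≈-Reasoning setoid

  ∙≈∙⇒\\≈// : ∀ {g h x y} → h ∙ y ≈ g ∙ x → g \\ h ≈ x // y
  ∙≈∙⇒\\≈// {g} {h} {x} {y} eq = begin
    g ⁻¹ ∙ h                ≈⟨ //-rightDividesʳ y _ ⟨
    g ⁻¹ ∙ h ∙ y ∙ y ⁻¹     ≈⟨ ∙-congʳ (assoc _ _ _) ⟩
    g ⁻¹ ∙ (h ∙ y) ∙ y ⁻¹   ≈⟨ ∙-congʳ (∙-congˡ eq) ⟩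
    g ⁻¹ ∙ (g ∙ x) ∙ y ⁻¹   ≈⟨ ∙-congʳ (\\-leftDividesʳ g x) ⟩
    x ∙ y ⁻¹                ∎

  \\≈//⇒∙≈∙ : ∀ {g h x y} → g \\ h ≈ x // y → h ∙ y ≈ g ∙ x
  \\≈//⇒∙≈∙ {g} {h} {x} {y} eq = begin
    h ∙ y                   ≈⟨ ∙-congʳ (\\-leftDividesˡ g h) ⟨
    g ∙ (g ⁻¹ ∙ h) ∙ y      ≈⟨ ∙-congʳ (∙-congˡ eq) ⟩
    g ∙ (x ∙ y ⁻¹) ∙ y      ≈⟨ assoc _ _ _ ⟩
    g ∙ (x ∙ y ⁻¹ ∙ y)      ≈⟨ ∙-congˡ (//-rightDividesˡ y x) ⟩
    g ∙ x                   ∎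

module ConjugationProperties (G : Group c ℓ) where
  open Group G
  open GroupProperties G
  open ≈-Reasoning setoid

  conj-cong : ∀ {x y g h} → x ≈ y → g ≈ h → conj G x g ≈ conj G y h
  conj-cong x≈y g≈h = ∙-cong (∙-cong (⁻¹-cong g≈h) x≈y) g≈h

  conj-identityʳ : ∀ x → conj G x ε ≈ x
  conj-identityʳ x = begin
    ε ⁻¹ ∙ x ∙ ε   ≈⟨ identityʳ _ ⟩
    ε ⁻¹ ∙ x       ≈⟨ ∙-congʳ ε⁻¹≈ε ⟩
    ε ∙ x          ≈⟨ identityˡ x ⟩
    x              ∎

  conj-∙ : ∀ x g h → conj G x (g ∙ h) ≈ conj G (conj G x g) h
  conj-∙ x g h = begin
    (g ∙ h) ⁻¹ ∙ x ∙ (g ∙ h)        ≈⟨ ∙-congʳ (∙-congʳ (⁻¹-anti-homo-∙ g h)) ⟩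
    h ⁻¹ ∙ g ⁻¹ ∙ x ∙ (g ∙ h)       ≈⟨ ∙-congʳ (assoc _ _ _) ⟩
    h ⁻¹ ∙ (g ⁻¹ ∙ x) ∙ (g ∙ h)     ≈⟨ assoc _ _ _ ⟩
    h ⁻¹ ∙ (g ⁻¹ ∙ x ∙ (g ∙ h))     ≈⟨ ∙-congˡ (assoc _ _ _) ⟨
    h ⁻¹ ∙ (g ⁻¹ ∙ x ∙ g ∙ h)       ≈⟨ assoc _ _ _ ⟨
    h ⁻¹ ∙ (g ⁻¹ ∙ x ∙ g) ∙ h       ∎

  conj-cancel : ∀ {g h} x → g ∙ h ≈ ε → conj G (conj G x g) h ≈ x
  conj-cancel {g} {h} x gh≈ε = begin
    conj G (conj G x g) h   ≈⟨ conj-∙ x g h ⟨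
    conj G x (g ∙ h)        ≈⟨ conj-cong refl gh≈ε ⟩
    conj G x ε              ≈⟨ conj-identityʳ x ⟩
    x                       ∎

  ∙-conj-interchange : ∀ g x h y → g ∙ x ∙ (h ∙ y) ≈ g ∙ h ∙ (conj G x h ∙ y)
  ∙-conj-interchange g x h y = begin
    g ∙ x ∙ (h ∙ y)                 ≈⟨ assoc _ _ _ ⟩
    g ∙ (x ∙ (h ∙ y))               ≈⟨ ∙-congˡ (assoc _ _ _) ⟨
    g ∙ (x ∙ h ∙ y)                 ≈⟨ ∙-congˡ (∙-congʳ (\\-leftDividesˡ h _)) ⟨
    g ∙ (h ∙ (h ⁻¹ ∙ (x ∙ h)) ∙ y)  ≈⟨ ∙-congˡ (∙-congʳ (∙-congˡ (assoc _ _ _))) ⟨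
    g ∙ (h ∙ conj G x h ∙ y)        ≈⟨ ∙-congˡ (assoc _ _ _) ⟩
    g ∙ (h ∙ (conj G x h ∙ y))      ≈⟨ assoc _ _ _ ⟨
    g ∙ h ∙ (conj G x h ∙ y)        ∎

module _ {G : Group c₁ ℓ₁} {K : Group c₂ ℓ₂} where
  private
    module G = Group G
    module K = Group K
  open GroupMorphisms G.rawGroup K.rawGroup
  open GroupProperties K using (identityʳ-unique; inverseˡ-unique)

  ∙-homo⇒isGroupHomomorphism : ∀ {f} → (∀ {x y} → x G.≈ y → f x K.≈ f y)
    → (∀ x y → f (x G.∙ y) K.≈ f x K.∙ f y) → IsGroupHomomorphism f
  ∙-homo⇒isGroupHomomorphism {f} f-cong f-homo = record
    { isMonoidHomomorphism = record
      { isMagmaHomomorphism = record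
        { isRelHomomorphism = record { cong = f-cong }
        ; homo = f-homo
        }
      ; ε-homo = f-ε
      }
    ; ⁻¹-homo = f-⁻¹
    }
    where
    f-ε : f G.ε K.≈ K.ε
    f-ε = identityʳ-unique _ _ (K.trans (K.sym (f-homo _ _)) (f-cong (G.identityˡ G.ε)))

    f-⁻¹ : ∀ x → f (x G.⁻¹) K.≈ f x K.⁻¹
    f-⁻¹ x = inverseˡ-unique _ _ (K.trans (K.sym (f-homo _ _)) (K.trans (f-cong (G.inverseˡ x)) f-ε))

  module _ {f : G.Carrier → K.Carrier} (f-hom : IsGroupHomomorphism f) where
    open IsGroupHomomorphism f-hom

    \\-homo : ∀ x y → f (x G.\\ y) K.≈ f x K.\\ f y
    \\-homo x y = K.trans (homo (x G.⁻¹) y) (K.∙-congʳ (⁻¹-homo x))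

    //-homo : ∀ x y → f (x G.// y) K.≈ f x K.// f y
    //-homo x y = K.trans (homo x (y G.⁻¹)) (K.∙-congˡ (⁻¹-homo y))

    eval-homo : ∀ {k} {g : Fin k → G.Carrier} {g′ : Fin k → K.Carrier}
      → (∀ i → f (g i) K.≈ g′ i) → ∀ w → f (eval G g w) K.≈ eval K g′ w
    eval-homo f-g ε′      = ε-homo
    eval-homo f-g (gen i) = f-g i
    eval-homo f-g (inv w) = K.trans (⁻¹-homo _) (K.⁻¹-cong (eval-homo f-g w))
    eval-homo f-g (w · v) = K.trans (homo _ _) (K.∙-cong (eval-homo f-g w) (eval-homo f-g v))

rep : {k : ℕ} (E : Group c ℓ) {A : Set c₁} → (Fin k → Group.Carrier E)
    → (A → Group.Carrier E) → Word k → A → Group.Carrier E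
rep E t ι w a = Group._∙_ E (eval E t w) (ι a)

module RepresentativeProperties {k : ℕ} (N E : Group c ℓ) {ι : Group.Carrier N → Group.Carrier E}
                                (ι-hom : IsHom N E ι) (t : Fin k → Group.Carrier E) where
  private
    module N = Group N
  open Group E
  open GroupMorphisms.IsGroupHomomorphism ι-hom
  open ≈-Reasoning setoid

  rep-ε′ : ∀ a → rep E t ι ε′ a ≈ ι a
  rep-ε′ a = identityˡ (ι a)

  rep-gen : ∀ i → rep E t ι (gen i) N.ε ≈ t i
  rep-gen i = trans (∙-congˡ ε-homo) (identityʳ (t i))

  rep-∙ : ∀ w v {a} b {d} → ι d ≈ conj E (ι a) (eval E t v)
        → rep E t ι w a ∙ rep E t ι v b ≈ rep E t ι (w · v) (d N.∙ b)
  rep-∙ w v {a} b {d} ιd≈ = begin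
    eval E t w ∙ ι a ∙ (eval E t v ∙ ι b)                        ≈⟨ ConjugationProperties.∙-conj-interchange E _ _ _ _ ⟩
    eval E t w ∙ eval E t v ∙ (conj E (ι a) (eval E t v) ∙ ι b)  ≈⟨ ∙-congˡ (∙-congʳ ιd≈) ⟨
    eval E t w ∙ eval E t v ∙ (ι d ∙ ι b)                        ≈⟨ ∙-congˡ (homo d b) ⟨
    eval E t (w · v) ∙ ι (d N.∙ b)                               ∎

  rep≈rep⇔ : ∀ {w v a b} → rep E t ι w a ≈ rep E t ι v b ⇔ eval E t (inv v · w) ≈ ι (b N.// a)
  rep≈rep⇔ {w} {v} {a} {b} = mk⇔
    (λ eq → trans (∙≈∙⇒\\≈// eq) (sym (//-homo {G = N} {K = E} ι-hom b a)))
    (λ eq → \\≈//⇒∙≈∙ (trans eq (//-homo {G = N} {K = E} ι-hom b a)))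
    where open DivisionProperties E

module Extension {k : ℕ} (H N E : Group c ℓ) {s : Fin k → Group.Carrier H}
                 {ι : Group.Carrier N → Group.Carrier E} {sE : Fin k → Group.Carrier E}
                 {π : Group.Carrier E → Group.Carrier H}
                 (π-quotient : IsQuotientBy N E H ι π) (π-sE : ∀ i → Group._≈_ H (π (sE i)) (s i)) where
  private
    module H = Group H
    module E = Group E
    π-hom = proj₁ π-quotient
    kernel = proj₂ (proj₂ π-quotient)
  open GroupMorphisms.IsGroupHomomorphism π-hom

  π-eval : ∀ w → π (eval E sE w) H.≈ eval H s w
  π-eval = eval-homo π-hom π-sE

  π-ι : ∀ a → π (ι a) H.≈ H.ε
  π-ι a = Equivalence.from (kernel (ι a)) (a , E.refl)

  ∈N⇒relator : ∀ {w a} → eval E sE w E.≈ ι a → eval H s w H.≈ H.ε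
  ∈N⇒relator {w} {a} w≈ιa = H.trans (H.sym (π-eval w)) (H.trans (⟦⟧-cong w≈ιa) (π-ι a))

  relator⇒∈N : ∀ {w} → eval H s w H.≈ H.ε → ∃ λ a → ι a E.≈ eval E sE w
  relator⇒∈N {w} w≈ε = Equivalence.to (kernel (eval E sE w)) (H.trans (π-eval w) w≈ε)

  same-fibre⇒coset : ∀ {g x} → π g H.≈ π x → ∃ λ a → g E.∙ ι a E.≈ x
  same-fibre⇒coset {g} {x} πg≈πx =
    let a , ιa≈ = Equivalence.to (kernel (g E.\\ x)) g\\x∈kernel
    in a , E.trans (E.∙-congˡ ιa≈) (GroupProperties.\\-leftDividesˡ E g x)
    where
    open ≈-Reasoning H.setoid
    g\\x∈kernel : π (g E.\\ x) H.≈ H.ε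
    g\\x∈kernel = begin
      π (g E.\\ x)     ≈⟨ \\-homo {G = E} {K = H} π-hom g x ⟩
      π g H.\\ π x     ≈⟨ H.∙-congʳ (H.⁻¹-cong πg≈πx) ⟩
      π x H.\\ π x     ≈⟨ H.inverseˡ (π x) ⟩
      H.ε              ∎

  decompose : Generates H s → ∀ x → ∃₂ λ w a → x E.≈ rep E sE ι w a
  decompose gens x =
    let w , w≈πx = gens (π x)
        a , wa≈x = same-fibre⇒coset (H.trans (π-eval w) w≈πx)
    in w , a , E.sym wa≈x

  hom⇒PhiEqual : {E′ : Group c ℓ} {ι′ : Group.Carrier N → Group.Carrier E′} {s′ : Fin k → Group.Carrier E′}
    → {f : E.Carrier → Group.Carrier E′} → IsHom E E′ f
    → (∀ a → Group._≈_ E′ (f (ι a)) (ι′ a)) → (∀ i → Group._≈_ E′ (f (sE i)) (s′ i))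
    → PhiEqual H N E E′ s ι ι′ sE s′
  hom⇒PhiEqual {E′ = E′} f-hom f-ι f-s w w∈R =
    let a , ιa≈w = relator⇒∈N {w} w∈R
    in a , ιa≈w , E′.trans (E′.sym (f-ι a)) (E′.trans (F.⟦⟧-cong ιa≈w) (eval-homo f-hom f-s w))
    where
    module E′ = Group E′
    module F = GroupMorphisms.IsGroupHomomorphism f-hom

PhiEqual-sym : ∀ {k} {H N E₁ E₂ : Group c ℓ} {s : Fin k → Group.Carrier H}
  {ι₁ : Group.Carrier N → Group.Carrier E₁} {ι₂ : Group.Carrier N → Group.Carrier E₂}
  {s¹ : Fin k → Group.Carrier E₁} {s² : Fin k → Group.Carrier E₂}
  → PhiEqual H N E₁ E₂ s ι₁ ι₂ s¹ s² → PhiEqual H N E₂ E₁ s ι₂ ι₁ s² s¹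
PhiEqual-sym φ w w∈R = let a , ι₁a≈ , ι₂a≈ = φ w w∈R in a , ι₂a≈ , ι₁a≈

module _ {k : ℕ} (H N E₁ E₂ : Group c ℓ) {s : Fin k → Group.Carrier H}
         {ι₁ : Group.Carrier N → Group.Carrier E₁} {ι₂ : Group.Carrier N → Group.Carrier E₂}
         {s¹ : Fin k → Group.Carrier E₁} {s² : Fin k → Group.Carrier E₂}
         {π₁ : Group.Carrier E₁ → Group.Carrier H}
         (ι₁-mono : IsMono N E₁ ι₁) (ι₂-hom : IsHom N E₂ ι₂)
         (π₁-quotient : IsQuotientBy N E₁ H ι₁ π₁) (π₁-s¹ : ∀ i → Group._≈_ H (π₁ (s¹ i)) (s i))
         (φ : PhiEqual H N E₁ E₂ s ι₁ ι₂ s¹ s²) where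
  private
    module E₁ = Group E₁
    module E₂ = Group E₂
    module ι₁ = GroupMorphisms.IsGroupMonomorphism ι₁-mono
    module ι₂ = GroupMorphisms.IsGroupHomomorphism ι₂-hom

  rep-transfer : ∀ w a v b → rep E₁ s¹ ι₁ w a E₁.≈ rep E₁ s¹ ι₁ v b
               → rep E₂ s² ι₂ w a E₂.≈ rep E₂ s² ι₂ v b
  rep-transfer w a v b eq₁ =
    let v⁻¹w≈ = Equivalence.to (R₁.rep≈rep⇔ {w} {v} {a} {b}) eq₁
        c , ι₁c≈ , ι₂c≈ = φ (inv v · w) (∈N⇒relator {inv v · w} v⁻¹w≈)
    in Equivalence.from (R₂.rep≈rep⇔ {w} {v} {a} {b})
         (E₂.trans (E₂.sym ι₂c≈) (ι₂.⟦⟧-cong (ι₁.injective (E₁.trans ι₁c≈ v⁻¹w≈))))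
    where
    module R₁ = RepresentativeProperties N E₁ ι₁.isGroupHomomorphism s¹
    module R₂ = RepresentativeProperties N E₂ ι₂-hom s²
    open Extension H N E₁ π₁-quotient π₁-s¹ using (∈N⇒relator)

module ConjugationAgreement (N E₁ E₂ : Group c ℓ)
         (ι₁ : Group.Carrier N → Group.Carrier E₁) (ι₂ : Group.Carrier N → Group.Carrier E₂) where
  private
    module N = Group N
    module E₁ = Group E₁
    module E₂ = Group E₂
    module C₁ = ConjugationProperties E₁
    module C₂ = ConjugationProperties E₂

  ConjAgree : E₁.Carrier → E₂.Carrier → Set (c ⊔ ℓ)
  ConjAgree t¹ t² = ∀ a → ∃ λ b → ι₁ b E₁.≈ conj E₁ (ι₁ a) t¹ × ι₂ b E₂.≈ conj E₂ (ι₂ a) t²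

  conjAgree-ε : ConjAgree E₁.ε E₂.ε
  conjAgree-ε a = a , E₁.sym (C₁.conj-identityʳ _) , E₂.sym (C₂.conj-identityʳ _)

  conjAgree-∙ : ∀ {t¹ t² u¹ u²} → ConjAgree t¹ t² → ConjAgree u¹ u²
              → ConjAgree (t¹ E₁.∙ u¹) (t² E₂.∙ u²)
  conjAgree-∙ {t¹} {t²} {u¹} {u²} t u a =
    let b , ι₁b≈ , ι₂b≈ = t a
        d , ι₁d≈ , ι₂d≈ = u b
    in d , E₁.trans ι₁d≈ (E₁.trans (C₁.conj-cong ι₁b≈ E₁.refl) (E₁.sym (C₁.conj-∙ _ t¹ u¹)))
         , E₂.trans ι₂d≈ (E₂.trans (C₂.conj-cong ι₂b≈ E₂.refl) (E₂.sym (C₂.conj-∙ _ t² u²)))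

  module _ (ι₁-normal : IsNormalEmbedding N E₁ ι₁) (ι₂-hom : IsHom N E₂ ι₂) where
    private
      module ι₁ = GroupMorphisms.IsGroupMonomorphism (proj₁ ι₁-normal)
      module ι₂ = GroupMorphisms.IsGroupHomomorphism ι₂-hom

    -- Normality gives b ∈ N with ι₁ b = (ι₁ a)^(t¹)⁻¹; agreement at b then yields ι₂ b = (ι₂ a)^(t²)⁻¹.
    conjAgree-⁻¹ : ∀ {t¹ t²} → ConjAgree t¹ t² → ConjAgree (t¹ E₁.⁻¹) (t² E₂.⁻¹)
    conjAgree-⁻¹ {t¹} {t²} t a =
      let b , ι₁b≈ = proj₂ ι₁-normal a (t¹ E₁.⁻¹)
          d , ι₁d≈ , ι₂d≈ = t b
          d≈a : d N.≈ a
          d≈a = ι₁.injective (E₁.trans ι₁d≈ (E₁.trans (C₁.conj-cong ι₁b≈ E₁.refl) (C₁.conj-cancel _ (E₁.inverseˡ t¹))))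
      in b , ι₁b≈ , E₂.trans (E₂.sym (C₂.conj-cancel _ (E₂.inverseʳ t²)))
                             (C₂.conj-cong (E₂.trans (E₂.sym ι₂d≈) (ι₂.⟦⟧-cong d≈a)) E₂.refl)

    conjAgree-eval : ∀ {k} {s¹ : Fin k → E₁.Carrier} {s² : Fin k → E₂.Carrier}
      → (∀ i → ConjAgree (s¹ i) (s² i)) → ∀ w → ConjAgree (eval E₁ s¹ w) (eval E₂ s² w)
    conjAgree-eval agree ε′      = conjAgree-ε
    conjAgree-eval agree (gen i) = agree i
    conjAgree-eval agree (inv w) = conjAgree-⁻¹ (conjAgree-eval agree w)
    conjAgree-eval agree (w · v) = conjAgree-∙ (conjAgree-eval agree w) (conjAgree-eval agree v)

module Construction {k : ℕ} (H N E₁ E₂ : Group c ℓ) {s : Fin k → Group.Carrier H} (gens : Generates H s)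
  {ι₁ : Group.Carrier N → Group.Carrier E₁} {ι₂ : Group.Carrier N → Group.Carrier E₂}
  (ι₁-normal : IsNormalEmbedding N E₁ ι₁) (ι₂-normal : IsNormalEmbedding N E₂ ι₂)
  {s¹ : Fin k → Group.Carrier E₁} {s² : Fin k → Group.Carrier E₂}
  {π₁ : Group.Carrier E₁ → Group.Carrier H} {π₂ : Group.Carrier E₂ → Group.Carrier H}
  (π₁-quotient : IsQuotientBy N E₁ H ι₁ π₁) (π₁-s¹ : ∀ i → Group._≈_ H (π₁ (s¹ i)) (s i))
  (π₂-quotient : IsQuotientBy N E₂ H ι₂ π₂) (π₂-s² : ∀ i → Group._≈_ H (π₂ (s² i)) (s i))
  (agree : ∀ i → ConjugationAgreement.ConjAgree N E₁ E₂ ι₁ ι₂ (s¹ i) (s² i))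
  (φ : PhiEqual H N E₁ E₂ s ι₁ ι₂ s¹ s²) where
  private
    module N = Group N
    module E₁ = Group E₁
    module E₂ = Group E₂
    ι₁-mono = proj₁ ι₁-normal
    ι₂-mono = proj₁ ι₂-normal
    ι₁-hom = GroupMorphisms.IsGroupMonomorphism.isGroupHomomorphism ι₁-mono
    ι₂-hom = GroupMorphisms.IsGroupMonomorphism.isGroupHomomorphism ι₂-mono
    module X₁ = Extension H N E₁ π₁-quotient π₁-s¹
    module X₂ = Extension H N E₂ π₂-quotient π₂-s²
    module R₁ = RepresentativeProperties N E₁ ι₁-hom s¹
    module R₂ = RepresentativeProperties N E₂ ι₂-hom s²
    open ConjugationAgreement N E₁ E₂ ι₁ ι₂ using (conjAgree-eval)

    rep₁ : Word k → N.Carrier → E₁.Carrier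
    rep₁ = rep E₁ s¹ ι₁

    rep₂ : Word k → N.Carrier → E₂.Carrier
    rep₂ = rep E₂ s² ι₂

    transfer₁₂ : ∀ w a v b → rep₁ w a E₁.≈ rep₁ v b → rep₂ w a E₂.≈ rep₂ v b
    transfer₁₂ = rep-transfer H N E₁ E₂ ι₁-mono ι₂-hom π₁-quotient π₁-s¹ φ

    transfer₂₁ : ∀ w a v b → rep₂ w a E₂.≈ rep₂ v b → rep₁ w a E₁.≈ rep₁ v b
    transfer₂₁ = rep-transfer H N E₂ E₁ ι₂-mono ι₁-hom π₂-quotient π₂-s² (PhiEqual-sym {H = H} {N = N} {E₁ = E₁} {E₂ = E₂} φ)

  f : E₁.Carrier → E₂.Carrier
  f x = let w , a , _ = X₁.decompose gens x in rep₂ w a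

  f-rep : ∀ {x} w a → x E₁.≈ rep₁ w a → f x E₂.≈ rep₂ w a
  f-rep {x} w a x≈ = let w′ , a′ , x≈′ = X₁.decompose gens x in transfer₁₂ w′ a′ w a (E₁.trans (E₁.sym x≈′) x≈)

  f-cong : ∀ {x y} → x E₁.≈ y → f x E₂.≈ f y
  f-cong {y = y} x≈y = let w , a , y≈ = X₁.decompose gens y in f-rep w a (E₁.trans x≈y y≈)

  f-homo : ∀ x y → f (x E₁.∙ y) E₂.≈ f x E₂.∙ f y
  f-homo x y =
    let w , a , x≈ = X₁.decompose gens x
        v , b , y≈ = X₁.decompose gens y
        d , ι₁d≈ , ι₂d≈ = conjAgree-eval ι₁-normal ι₂-hom agree v a
    in begin
      f (x E₁.∙ y)               ≈⟨ f-rep (w · v) (d N.∙ b) (E₁.trans (E₁.∙-cong x≈ y≈) (R₁.rep-∙ w v b ι₁d≈)) ⟩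
      rep₂ (w · v) (d N.∙ b)     ≈⟨ R₂.rep-∙ w v b ι₂d≈ ⟨
      rep₂ w a E₂.∙ rep₂ v b     ≈⟨ E₂.∙-cong (f-rep w a x≈) (f-rep v b y≈) ⟨
      f x E₂.∙ f y               ∎
    where open ≈-Reasoning E₂.setoid

  f-injective : ∀ {x y} → f x E₂.≈ f y → x E₁.≈ y
  f-injective {x} {y} fx≈fy =
    let w , a , x≈ = X₁.decompose gens x
        v , b , y≈ = X₁.decompose gens y
    in E₁.trans x≈ (E₁.trans (transfer₂₁ w a v b (E₂.trans (E₂.sym (f-rep w a x≈)) (E₂.trans fx≈fy (f-rep v b y≈))))
                             (E₁.sym y≈))

  f-surjective : ∀ y → ∃ λ x → ∀ {z} → z E₁.≈ x → f z E₂.≈ y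
  f-surjective y = let w , a , y≈ = X₂.decompose gens y in
    rep₁ w a , λ z≈ → E₂.trans (f-rep w a z≈) (E₂.sym y≈)

  f-isIso : IsIso E₁ E₂ f
  f-isIso = record
    { isGroupMonomorphism = record
      { isGroupHomomorphism = ∙-homo⇒isGroupHomomorphism {G = E₁} {K = E₂} f-cong f-homo
      ; injective = f-injective
      }
    ; surjective = f-surjective
    }

  f-ι : ∀ a → f (ι₁ a) E₂.≈ ι₂ a
  f-ι a = E₂.trans (f-rep ε′ a (E₁.sym (R₁.rep-ε′ a))) (R₂.rep-ε′ a)

  f-s : ∀ i → f (s¹ i) E₂.≈ s² i
  f-s i = E₂.trans (f-rep (gen i) N.ε (E₁.sym (R₁.rep-gen i))) (R₂.rep-gen i)

lemma6p1 : {c ℓ : Level} (k : ℕ) (H N E₁ E₂ : Group c ℓ)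
    → Finite H → Finite E₁ → Finite E₂
    → (s : Fin k → Group.Carrier H) → Generates H s
    → (ι₁ : Group.Carrier N → Group.Carrier E₁) → IsNormalEmbedding N E₁ ι₁
    → (ι₂ : Group.Carrier N → Group.Carrier E₂) → IsNormalEmbedding N E₂ ι₂
    → (s¹ : Fin k → Group.Carrier E₁) (s² : Fin k → Group.Carrier E₂)
    → (π₁ : Group.Carrier E₁ → Group.Carrier H) → IsQuotientBy N E₁ H ι₁ π₁
    → (∀ i → Group._≈_ H (π₁ (s¹ i)) (s i))
    → (π₂ : Group.Carrier E₂ → Group.Carrier H) → IsQuotientBy N E₂ H ι₂ π₂
    → (∀ i → Group._≈_ H (π₂ (s² i)) (s i))
    → (∀ i a → ∃ λ b → Group._≈_ E₁ (ι₁ b) (conj E₁ (ι₁ a) (s¹ i))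
                     × Group._≈_ E₂ (ι₂ b) (conj E₂ (ι₂ a) (s² i)))
    → (Σ (Group.Carrier E₁ → Group.Carrier E₂) λ f →
          IsIso E₁ E₂ f
          × (∀ a → Group._≈_ E₂ (f (ι₁ a)) (ι₂ a))
          × (∀ i → Group._≈_ E₂ (f (s¹ i)) (s² i)))
      ⇔ PhiEqual H N E₁ E₂ s ι₁ ι₂ s¹ s²
lemma6p1 k H N E₁ E₂ _ _ _ s gens ι₁ ι₁-normal ι₂ ι₂-normal s¹ s² π₁ π₁-quotient π₁-s¹ π₂ π₂-quotient π₂-s² agree =
  mk⇔ (λ (f , f-iso , f-ι , f-s) →
         Extension.hom⇒PhiEqual H N E₁ π₁-quotient π₁-s¹ (GroupMorphisms.IsGroupIsomorphism.isGroupHomomorphism f-iso) f-ι f-s)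
      (λ φ → let open Construction H N E₁ E₂ gens ι₁-normal ι₂-normal π₁-quotient π₁-s¹ π₂-quotient π₂-s² agree φ
             in f , f-isIso , f-ι , f-s)
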